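{- Let $s\ge1$, let $w=(x_1,\dots,x_n)\in\mathcal I_n$ with set of distinct entries $\{y_1<\dots<y_k\}$, put $y_{k+1}=n$, and let $A=\Phi(w)$. Then $A$ is $s$-diagonal if and only if for every $i\in[1,n]$ there exists $a(i)\in[1,k]$ such that $$y_{a(i)}<i\le y_{a(i)+1}\quad\text{and}\quad x_i\in\{y_{a(i)},y_{a(i)-1},\dots,y_{\max(1,a(i)-s+1)}\}.$$
   Context: $[a,b]=\{i\in\mathbb Z:a\le i\le b\}$. $\mathcal I_n$ is the set of integer sequences $(x_1,\dots,x_n)$ with $0\le x_\ell\le\ell-1$. For $w\in\mathcal I_n$ with distinct entries $y_1<\dots<y_k$ and $y_{k+1}:=n$, $\Phi(w)$ is the $k\times k$ matrix whose $(i,j)$ entry is $\{\ell\in[1,n]: x_\ell=y_i\text{ and }y_j<\ell\le y_{j+1}\}$. A $k\times k$ matrix $A$ with set entries is $s$-diagonal if it is upper triangular and $A_{ij}=\emptyset$ whenever $j-i\ge s$. -}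

module Defs where

open import Data.Nat using (ℕ; zero; suc; _+_; _≤_; _<_)
open import Data.Fin using (Fin; zero; suc; toℕ)
import Data.Fin as F
open import Data.Product using (Σ; ∃-syntax; _×_)
open import Function using (_∘_)
open import Function.Bundles using (_⇔_)
open import Relation.Binary.PropositionalEquality using (_≡_)
open import Relation.Unary using (Pred; Empty)
open import Level using (0ℓ)

-- Conventions: positions ℓ ∈ [1,n] are represented by (ℓ' : Fin n) with ℓ = suc (toℕ ℓ').
-- Row/column indices i ∈ [1,k] are represented by (i' : Fin k) with i = suc (toℕ i').

pos : ∀ {n} → Fin n → ℕ
pos ℓ = suc (toℕ ℓ)

InI : (n : ℕ) → (Fin n → ℕ) → Set
InI n w = (ℓ : Fin n) → w ℓ ≤ toℕ ℓ

StrictlyIncreasing : ∀ {k} → (Fin k → ℕ) → Set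
StrictlyIncreasing {k} y = (i j : Fin k) → i F.< j → y i < y j

DistinctEntries : ∀ {n k} → (Fin n → ℕ) → (Fin k → ℕ) → Set
DistinctEntries {n} {k} w y =
  StrictlyIncreasing y × ((v : ℕ) → (∃[ ℓ ] w ℓ ≡ v) ⇔ (∃[ i ] y i ≡ v))

-- ynext n y j = y_{j+1}, with the convention y_{k+1} = n
ynext : ∀ {k} → ℕ → (Fin k → ℕ) → Fin k → ℕ
ynext {suc zero} n y zero = n
ynext {suc (suc k)} n y zero = y (suc zero)
ynext {suc (suc k)} n y (suc j) = ynext n (y ∘ suc) j

Φ : ∀ {n k} → (Fin n → ℕ) → (Fin k → ℕ) → Fin k → Fin k → Pred (Fin n) 0ℓ
Φ {n} w y i j ℓ = (w ℓ ≡ y i) × (y j < pos ℓ) × (pos ℓ ≤ ynext n y j)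

SDiagonal : ∀ {n k} → ℕ → (Fin k → Fin k → Pred (Fin n) 0ℓ) → Set
SDiagonal {n} {k} s A =
  ((i j : Fin k) → toℕ j < toℕ i → Empty (A i j)) ×
  ((i j : Fin k) → toℕ i + s ≤ toℕ j → Empty (A i j))

module Submission where

-- The blocks (y_a, y_{a+1}] (with y_{k+1} = n) are pairwise
-- disjoint because y is strictly increasing, and they cover every position
-- ℓ ∈ [1,n] because x_ℓ = y_b for some b and x_ℓ ≤ ℓ - 1.  Hence each
-- position ℓ lies in exactly one column a of Φ(w), namely its block, and in
-- exactly one row b,
-- namely the index with y_b = x_ℓ; i.e. ℓ ∈ Φ(w)_{ba} holds precisely when
-- a is the block of ℓ and x_ℓ = y_b.
--
-- The theorem follows: the condition
-- on w says that for every ℓ the unique entry of Φ(w) containing ℓ lies in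
-- the band.

open import Defs
open import Data.Nat using (ℕ; zero; suc; _+_; _≤_; _<_; z≤n; s≤s)
open import Data.Nat.Properties using (≤-refl; ≤-trans; <⇒≤; ≤-<-trans; <-irrefl; ≮⇒≥; ≰⇒>; _<?_)
open import Data.Fin using (Fin; toℕ) renaming (zero to fz; suc to fs)
import Data.Fin as F
open import Data.Fin.Properties using (<-cmp; toℕ<n)
open import Data.Product using (∃-syntax; _×_; _,_; proj₁; proj₂)
open import Function using (_∘_)
open import Function.Bundles using (_⇔_; mk⇔; Equivalence)
open import Relation.Binary.PropositionalEquality using (_≡_; refl; sym; trans; subst)
open import Relation.Binary.Definitions using (tri<; tri≈; tri>)
open import Relation.Nullary using (yes; no)
open import Data.Empty using (⊥; ⊥-elim)
open import Level using (0ℓ)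
open import Relation.Unary using (Pred)

tail-increasing : ∀ {k} (y : Fin (suc k) → ℕ) → StrictlyIncreasing y → StrictlyIncreasing (y ∘ fs)
tail-increasing y inc i j i<j = inc (fs i) (fs j) (s≤s i<j)

head-least : ∀ {k} (y : Fin (suc k) → ℕ) → StrictlyIncreasing y → (i : Fin (suc k)) → y fz ≤ y i
head-least y inc fz = ≤-refl
head-least y inc (fs i) = <⇒≤ (inc fz (fs i) (s≤s z≤n))

increasing-injective : ∀ {k} (y : Fin k → ℕ) → StrictlyIncreasing y → (i j : Fin k) → y i ≡ y j → i ≡ j
increasing-injective y inc i j yi≡yj with <-cmp i j
... | tri< i<j _ _ = ⊥-elim (<-irrefl yi≡yj (inc i j i<j))
... | tri≈ _ i≡j _ = i≡j
... | tri> _ _ j<i = ⊥-elim (<-irrefl (sym yi≡yj) (inc j i j<i))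

InBlock : ∀ {k} → ℕ → (Fin k → ℕ) → Fin k → ℕ → Set
InBlock n y a p = (y a < p) × (p ≤ ynext n y a)

ynext-≤-later : ∀ {k} n (y : Fin k → ℕ) → StrictlyIncreasing y →
  (j j' : Fin k) → j F.< j' → ynext n y j ≤ y j'
ynext-≤-later {suc zero} n y inc fz fz ()
ynext-≤-later {suc (suc k)} n y inc fz (fs j') _ = head-least (y ∘ fs) (tail-increasing y inc) j'
ynext-≤-later {suc (suc k)} n y inc (fs j) (fs j') (s≤s j<j') =
  ynext-≤-later n (y ∘ fs) (tail-increasing y inc) j j' j<j'

block-unique : ∀ {k} n (y : Fin k → ℕ) → StrictlyIncreasing y → (p : ℕ) (j j' : Fin k) →
  InBlock n y j p → InBlock n y j' p → j ≡ j'
block-unique n y inc p j j' (yj<p , p≤nextj) (yj'<p , p≤nextj') with <-cmp j j'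
... | tri< j<j' _ _ = ⊥-elim (<-irrefl refl (≤-<-trans (≤-trans p≤nextj (ynext-≤-later n y inc j j' j<j')) yj'<p))
... | tri≈ _ j≡j' _ = j≡j'
... | tri> _ _ j'<j = ⊥-elim (<-irrefl refl (≤-<-trans (≤-trans p≤nextj' (ynext-≤-later n y inc j' j j'<j)) yj<p))

-- Every p with y_1 < p ≤ n lies in some block: take the last a with y_a < p.
block-exists-from-head : ∀ {k} n (y : Fin (suc k) → ℕ) (p : ℕ) →
  y fz < p → p ≤ n → ∃[ a ] InBlock n y a p
block-exists-from-head {zero} n y p y₁<p p≤n = fz , y₁<p , p≤n
block-exists-from-head {suc k} n y p y₁<p p≤n with y (fs fz) <? p
... | yes y₂<p with block-exists-from-head n (y ∘ fs) p y₂<p p≤n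
...   | a , inBlock = fs a , inBlock
block-exists-from-head {suc k} n y p y₁<p p≤n | no y₂≮p = fz , y₁<p , ≮⇒≥ y₂≮p

block-exists : ∀ {k} n (y : Fin k → ℕ) → StrictlyIncreasing y → (c : Fin k) (p : ℕ) →
  y c < p → p ≤ n → ∃[ a ] InBlock n y a p
block-exists {suc k} n y inc c p yc<p p≤n =
  block-exists-from-head n y p (≤-<-trans (head-least y inc c) yc<p) p≤n

Band : ∀ {k} → ℕ → Fin k → Fin k → Set
Band s i j = (toℕ i ≤ toℕ j) × (toℕ j < toℕ i + s)

sdiagonal⇔band : ∀ {n k} (s : ℕ) (A : Fin k → Fin k → Pred (Fin n) 0ℓ) →
  SDiagonal s A ⇔ (∀ i j ℓ → A i j ℓ → Band s i j)
sdiagonal⇔band s A = mk⇔ toBand fromBand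
  where
  toBand : SDiagonal s A → ∀ i j ℓ → A i j ℓ → Band s i j
  toBand (below , beyond) i j ℓ ℓ∈Aij =
    ≮⇒≥ (λ j<i → below i j j<i ℓ ℓ∈Aij) , ≰⇒> (λ i+s≤j → beyond i j i+s≤j ℓ ℓ∈Aij)

  fromBand : (∀ i j ℓ → A i j ℓ → Band s i j) → SDiagonal s A
  fromBand band = below , beyond
    where
    below : (i j : Fin _) → toℕ j < toℕ i → ∀ ℓ → A i j ℓ → ⊥
    below i j j<i ℓ ℓ∈Aij with band i j ℓ ℓ∈Aij
    ... | i≤j , _ = <-irrefl refl (≤-<-trans i≤j j<i)

    beyond : (i j : Fin _) → toℕ i + s ≤ toℕ j → ∀ ℓ → A i j ℓ → ⊥
    beyond i j i+s≤j ℓ ℓ∈Aij with band i j ℓ ℓ∈Aij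
    ... | _ , j<i+s = <-irrefl refl (≤-<-trans i+s≤j j<i+s)

Admissible : (s n : ℕ) {k : ℕ} → (Fin n → ℕ) → (Fin k → ℕ) → Set
Admissible s n w y =
  (ℓ : Fin n) → ∃[ a ] ((y a < pos ℓ) × (pos ℓ ≤ ynext n y a) ×
    (∃[ b ] ((toℕ b ≤ toℕ a) × (toℕ a < toℕ b + s) × (w ℓ ≡ y b))))

entry-index : ∀ {n k} (w : Fin n → ℕ) (y : Fin k → ℕ) → DistinctEntries w y →
  (ℓ : Fin n) → ∃[ b ] (y b ≡ w ℓ)
entry-index w y (_ , sameValues) ℓ = Equivalence.to (sameValues (w ℓ)) (ℓ , refl)

-- Every position ℓ lies in some block, since y_b = x_ℓ ≤ ℓ - 1 for some b.
position-in-block : ∀ {n k} (w : Fin n → ℕ) → InI n w → (y : Fin k → ℕ) → DistinctEntries w y →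
  (ℓ : Fin n) → ∃[ a ] InBlock n y a (pos ℓ)
position-in-block {n} w inI y entries@(inc , _) ℓ with entry-index w y entries ℓ
... | b , yb≡xℓ = block-exists n y inc b (pos ℓ) (s≤s (subst (_≤ toℕ ℓ) (sym yb≡xℓ) (inI ℓ))) (toℕ<n ℓ)

-- If the nonempty entries of Φ(w) lie in the band, w satisfies the condition:
-- ℓ belongs to the entry (b, a) with a its block and y_b = x_ℓ.
band⇒admissible : ∀ {n k} (s : ℕ) (w : Fin n → ℕ) → InI n w → (y : Fin k → ℕ) → DistinctEntries w y →
  (∀ i j ℓ → Φ w y i j ℓ → Band s i j) → Admissible s n w y
band⇒admissible s w inI y entries band ℓ
  with position-in-block w inI y entries ℓ | entry-index w y entries ℓ
... | a , inBlock | b , yb≡xℓ with band b a ℓ (sym yb≡xℓ , inBlock)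
...   | b≤a , a<b+s = a , proj₁ inBlock , proj₂ inBlock , b , b≤a , a<b+s , sym yb≡xℓ

-- Conversely, under the condition, ℓ ∈ Φ(w)_{ij} forces j to be the block a
-- of ℓ (blocks are disjoint) and i = b (y is injective), so (i, j) is in the band.
admissible⇒band : ∀ {n k} (s : ℕ) (w : Fin n → ℕ) (y : Fin k → ℕ) → StrictlyIncreasing y →
  Admissible s n w y → ∀ i j ℓ → Φ w y i j ℓ → Band s i j
admissible⇒band {n} s w y inc admissible i j ℓ (xℓ≡yi , inBlockJ)
  with admissible ℓ
... | a , yₐ<p , p≤yₐ₊₁ , b , b≤a , a<b+s , xℓ≡yb
  with block-unique n y inc (pos ℓ) a j (yₐ<p , p≤yₐ₊₁) inBlockJ
     | increasing-injective y inc b i (trans (sym xℓ≡yb) xℓ≡yi)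
...   | refl | refl = b≤a , a<b+s

theorem10 : (s n k : ℕ) → 1 ≤ s → (w : Fin n → ℕ) → InI n w →
    (y : Fin k → ℕ) → DistinctEntries w y →
    SDiagonal s (Φ w y) ⇔
      ((ℓ : Fin n) → ∃[ a ] ((y a < pos ℓ) × (pos ℓ ≤ ynext n y a) ×
        (∃[ b ] ((toℕ b ≤ toℕ a) × (toℕ a < toℕ b + s) × (w ℓ ≡ y b)))))
theorem10 s n k _ w inI y entries@(inc , _) =
  mk⇔ (band⇒admissible s w inI y entries ∘ Equivalence.to bandForm)
      (Equivalence.from bandForm ∘ admissible⇒band s w y inc)
  where
  bandForm : SDiagonal s (Φ w y) ⇔ (∀ i j ℓ → Φ w y i j ℓ → Band s i j)
  bandForm = sdiagonal⇔band s (Φ w y)
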